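{- Let $q\in\mathbb{N}$ and let $(n_{1,i})_{i\ge1},(k_{1,i})_{i\ge1},\dots,(n_{q,i})_{i\ge1},(k_{q,i})_{i\ge1}$ be sequences in $\mathbb{Z}$. For finite nonempty $\alpha\subset\mathbb{N}$ put $n_{j,\alpha}=\sum_{i\in\alpha}n_{j,i}$ and $k_{j,\alpha}=\sum_{i\in\alpha}k_{j,i}$. Then for any finite coloring of $\mathbb{Z}$ there exist $a\in\mathbb{Z}$ and a finite nonempty set $\gamma\subset\mathbb{N}$ such that the set $$\{a,\ a+n_{1,\gamma}k_{1,\gamma},\ \dots,\ a+n_{q,\gamma}k_{q,\gamma}\}$$ is monochromatic.
   Context: A finite coloring of $\mathbb{Z}$ is a map $\chi:\mathbb{Z}\to\{1,\dots,r\}$ for some $r$; a set is monochromatic if $\chi$ is constant on it. -}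

module Defs where

open import Data.Nat using (ℕ; _≥_)
open import Data.Integer using (ℤ; _+_; 0ℤ)
open import Data.List using (List; []; _∷_; foldr; map)
open import Data.List.Relation.Unary.All using (All)
open import Data.List.Relation.Unary.Unique.Propositional using (Unique)
open import Data.Product using (_×_)
open import Data.Empty using (⊥)
open import Relation.Binary.PropositionalEquality using (_≢_)

-- A finite nonempty subset α of ℕ = {1,2,3,...} is represented by a
-- duplicate-free nonempty list of its elements, all ≥ 1.
FinNonemptySubset : List ℕ → Set
FinNonemptySubset α = Unique α × (α ≢ []) × All (λ i → i ≥ 1) α

-- n_α = Σ_{i ∈ α} n_i  (well defined on sets since α has no duplicates
-- and addition is commutative)
sumOver : (ℕ → ℤ) → List ℕ → ℤ
sumOver n α = foldr _+_ 0ℤ (map n α)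

module Submission where

-- For disjoint S, γ every P β = Σ_{i,j∈β} K i j + Σ_{i∈β} L i satisfies P (S ∪ γ) = P S + P′ γ,
-- where P′ has the kernel K and the linear part L plus the polarisation of K at S. So if Q is a
-- linear member of a family of such polynomials, or the quadratic part of one of its kernels, the
-- remainders P (S ∪ γ) − P S − Q γ form a family with fewer kernels, or with as many kernels and
-- fewer linear members; this is the PET induction. Its step is colour focusing: a shift x + R γ
-- that is monochromatic for all remainders R, with respect to the colours at finitely many points,
-- turns a focus f whose levels S₁, …, S_s carry distinct colours into the focus x + f − Q γ with
-- levels γ, S₁ ∪ γ, …, S_s ∪ γ, unless the colour of x + f already occurs, which gives a solution.
-- After r + 1 rounds there are too many distinct colours. The products n_{j,γ} k_{j,γ} are the
-- quadratic forms of the kernels n_j ⊗ k_j.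

open import Defs
open import Data.Nat using (ℕ; zero; suc; _≤_; _<_; _^_)
open import Data.Nat.Properties using (≤-refl; ≤-<-trans; <-irrefl; n<1+n; suc-injective)
open import Data.Integer using (ℤ; _+_; _-_; _*_; -_; 0ℤ)
open import Data.Integer.Properties
  using (+-identityˡ; +-identityʳ; +-assoc; +-inverseʳ; *-distribˡ-+; *-distribʳ-+; *-zeroˡ; *-zeroʳ)
open import Data.Integer.Tactic.RingSolver using (solve-∀)
open import Data.List
  using (List; []; _∷_; _++_; map; concat; concatMap; cartesianProductWith; length; lookup; allFin)
open import Data.List.Properties using (length-map; ++-conicalˡ)
open import Data.List.Extrema.Nat using (max; xs≤max; v≤max⁺)
open import Data.List.Membership.Propositional using (_∈_; find; lose)
open import Data.List.Membership.Propositional.Properties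
  using (∈-map⁺; ∈-map⁻; ∈-++⁺ˡ; ∈-++⁺ʳ; ∈-++⁻; ∈-concat⁺′; ∈-concatMap⁺; ∈-concatMap⁻;
         ∈-tabulate⁺; ∈-tabulate⁻; ∈-cartesianProductWith⁺; ∈-cartesianProductWith⁻; ∈-allFin)
open import Data.List.Relation.Unary.All as All using (All; []; _∷_)
import Data.List.Relation.Unary.All.Properties as All
open import Data.List.Relation.Unary.Any as Any using (here; there)
open import Data.List.Relation.Unary.Any.Properties using (lookup-index)
open import Data.List.Relation.Unary.AllPairs using ([]; _∷_)
open import Data.List.Relation.Unary.Unique.Propositional using (Unique)
import Data.List.Relation.Unary.Unique.Propositional.Properties as Unique
open import Data.Fin using (Fin; zero; suc; funToFin; finToFun)
open import Data.Fin.Properties using (finToFun-funToFin; any?; <⇒notInjective) renaming (_≟_ to _≟ᶠ_)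
open import Data.Vec.Functional as Vector using (Vector; toList)
open import Data.Product using (Σ; ∃-syntax; _×_; _,_; proj₁; proj₂)
open import Data.Sum using (_⊎_; inj₁; inj₂; [_,_]′)
open import Data.Empty using (⊥-elim)
open import Function using (_∘_; id)
open import Function.Definitions using (Injective)
open import Relation.Nullary using (¬_; yes; no)
open import Relation.Binary.PropositionalEquality

sumOver-++ : ∀ f xs ys → sumOver f (xs ++ ys) ≡ sumOver f xs + sumOver f ys
sumOver-++ f []       ys = sym (+-identityˡ _)
sumOver-++ f (x ∷ xs) ys = trans (cong (f x +_) (sumOver-++ f xs ys)) (sym (+-assoc (f x) _ _))

sumOver-cong : ∀ {f g} β → (∀ i → f i ≡ g i) → sumOver f β ≡ sumOver g β
sumOver-cong []      f≗g = refl
sumOver-cong (x ∷ β) f≗g = cong₂ _+_ (f≗g x) (sumOver-cong β f≗g)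

sumOver-zero : ∀ β → sumOver (λ _ → 0ℤ) β ≡ 0ℤ
sumOver-zero []      = refl
sumOver-zero (x ∷ β) = trans (+-identityˡ _) (sumOver-zero β)

sumOver-+ : ∀ f g β → sumOver (λ i → f i + g i) β ≡ sumOver f β + sumOver g β
sumOver-+ f g []      = refl
sumOver-+ f g (x ∷ β) =
  trans (cong (f x + g x +_) (sumOver-+ f g β)) (interchange (f x) (g x) (sumOver f β) (sumOver g β))
  where
  interchange : ∀ a b c d → a + b + (c + d) ≡ a + c + (b + d)
  interchange = solve-∀

sumOver-- : ∀ f g β → sumOver (λ i → f i - g i) β ≡ sumOver f β - sumOver g β
sumOver-- f g []      = refl
sumOver-- f g (x ∷ β) =
  trans (cong (f x - g x +_) (sumOver-- f g β)) (interchange (f x) (g x) (sumOver f β) (sumOver g β))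
  where
  interchange : ∀ a b c d → a - b + (c - d) ≡ a + c - (b + d)
  interchange = solve-∀

sumOver-*ˡ : ∀ c f β → sumOver (λ i → c * f i) β ≡ c * sumOver f β
sumOver-*ˡ c f []      = sym (*-zeroʳ c)
sumOver-*ˡ c f (x ∷ β) = trans (cong (c * f x +_) (sumOver-*ˡ c f β)) (sym (*-distribˡ-+ c (f x) _))

sumOver-*ʳ : ∀ c f β → sumOver (λ i → f i * c) β ≡ sumOver f β * c
sumOver-*ʳ c f []      = sym (*-zeroˡ c)
sumOver-*ʳ c f (x ∷ β) = trans (cong (f x * c +_) (sumOver-*ʳ c f β)) (sym (*-distribʳ-+ c (f x) _))

sumOver-swap : ∀ (K : ℕ → ℕ → ℤ) α β →
  sumOver (λ i → sumOver (K i) β) α ≡ sumOver (λ j → sumOver (λ i → K i j) α) β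
sumOver-swap K []      β = sym (sumOver-zero β)
sumOver-swap K (x ∷ α) β =
  trans (cong (sumOver (K x) β +_) (sumOver-swap K α β)) (sym (sumOver-+ (K x) _ β))

-- Quadratic forms

Kernel : Set
Kernel = ℕ → ℕ → ℤ

quadratic : Kernel → List ℕ → ℤ
quadratic K β = sumOver (λ i → sumOver (K i) β) β

polar : Kernel → List ℕ → ℕ → ℤ
polar K S j = sumOver (λ i → K i j + K j i) S

_⊗_ : (ℕ → ℤ) → (ℕ → ℤ) → Kernel
(n ⊗ k) i j = n i * k j

_⊟_ : Kernel → Kernel → Kernel
(K ⊟ K₀) i j = K i j - K₀ i j

quadratic-++ : ∀ K S γ →
  quadratic K (S ++ γ) ≡ quadratic K S + quadratic K γ + sumOver (polar K S) γ
quadratic-++ K S γ = begin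
    sumOver (λ i → sumOver (K i) (S ++ γ)) (S ++ γ)
  ≡⟨ sumOver-cong (S ++ γ) (λ i → sumOver-++ (K i) S γ) ⟩
    sumOver (λ i → sumOver (K i) S + sumOver (K i) γ) (S ++ γ)
  ≡⟨ sumOver-+ _ _ (S ++ γ) ⟩
    sumOver (λ i → sumOver (K i) S) (S ++ γ) + sumOver (λ i → sumOver (K i) γ) (S ++ γ)
  ≡⟨ cong₂ _+_ (sumOver-++ _ S γ) (sumOver-++ _ S γ) ⟩
    quadratic K S + γS + (Sγ + quadratic K γ)
  ≡⟨ cong (λ z → quadratic K S + γS + (z + quadratic K γ)) (sumOver-swap K S γ) ⟩
    quadratic K S + γS + (Sγ′ + quadratic K γ)
  ≡⟨ regroup (quadratic K S) γS Sγ′ (quadratic K γ) ⟩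
    quadratic K S + quadratic K γ + (Sγ′ + γS)
  ≡⟨ cong (quadratic K S + quadratic K γ +_) (sym (sumOver-+ _ _ γ)) ⟩
    quadratic K S + quadratic K γ + sumOver (λ j → sumOver (λ i → K i j) S + sumOver (K j) S) γ
  ≡⟨ cong (quadratic K S + quadratic K γ +_)
          (sumOver-cong γ (λ j → sym (sumOver-+ (λ i → K i j) (K j) S))) ⟩
    quadratic K S + quadratic K γ + sumOver (polar K S) γ
  ∎
  where
  open ≡-Reasoning
  γS  = sumOver (λ i → sumOver (K i) S) γ
  Sγ  = sumOver (λ i → sumOver (K i) γ) S
  Sγ′ = sumOver (λ j → sumOver (λ i → K i j) S) γ
  regroup : ∀ a b c d → a + b + (c + d) ≡ a + d + (c + b)
  regroup = solve-∀

quadratic-⊟ : ∀ K K₀ β → quadratic (K ⊟ K₀) β ≡ quadratic K β - quadratic K₀ β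
quadratic-⊟ K K₀ β = trans (sumOver-cong β (λ i → sumOver-- (K i) (K₀ i) β)) (sumOver-- _ _ β)

quadratic-⊗ : ∀ n k β → quadratic (n ⊗ k) β ≡ sumOver n β * sumOver k β
quadratic-⊗ n k β = trans (sumOver-cong β (λ i → sumOver-*ˡ (n i) k β)) (sumOver-*ʳ (sumOver k β) n β)

_⊕_ : (ℕ → ℤ) → (ℕ → ℤ) → ℕ → ℤ
(l ⊕ m) i = l i + m i

_⊖_ : (ℕ → ℤ) → (ℕ → ℤ) → ℕ → ℤ
(l ⊖ m) i = l i - m i

Poly : Set
Poly = List ℕ → ℤ

quadraticPoly : Kernel → (ℕ → ℤ) → Poly
quadraticPoly K L β = quadratic K β + sumOver L β

quadraticPoly-++ : ∀ K L S γ →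
  quadraticPoly K L (S ++ γ) ≡ quadraticPoly K L S + quadraticPoly K (L ⊕ polar K S) γ
quadraticPoly-++ K L S γ = begin
    quadratic K (S ++ γ) + sumOver L (S ++ γ)
  ≡⟨ cong₂ _+_ (quadratic-++ K S γ) (sumOver-++ L S γ) ⟩
    quadratic K S + quadratic K γ + sumOver (polar K S) γ + (sumOver L S + sumOver L γ)
  ≡⟨ regroup (quadratic K S) (quadratic K γ) (sumOver (polar K S) γ) (sumOver L S) (sumOver L γ) ⟩
    quadraticPoly K L S + (quadratic K γ + (sumOver L γ + sumOver (polar K S) γ))
  ≡⟨ cong (λ z → quadraticPoly K L S + (quadratic K γ + z)) (sym (sumOver-+ L (polar K S) γ)) ⟩
    quadraticPoly K L S + quadraticPoly K (L ⊕ polar K S) γ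
  ∎
  where
  open ≡-Reasoning
  regroup : ∀ qS qγ p LS Lγ → qS + qγ + p + (LS + Lγ) ≡ qS + LS + (qγ + (Lγ + p))
  regroup = solve-∀

quadraticPoly-⊖ : ∀ K L l γ → quadraticPoly K (L ⊖ l) γ ≡ quadraticPoly K L γ - sumOver l γ
quadraticPoly-⊖ K L l γ =
  trans (cong (quadratic K γ +_) (sumOver-- L l γ))
        (sym (+-assoc (quadratic K γ) (sumOver L γ) (- sumOver l γ)))

quadraticPoly-⊟ : ∀ K K₀ L γ → quadraticPoly (K ⊟ K₀) L γ ≡ quadraticPoly K L γ - quadratic K₀ γ
quadraticPoly-⊟ K K₀ L γ =
  trans (cong (_+ sumOver L γ) (quadratic-⊟ K K₀ γ))
        (regroup (quadratic K γ) (quadratic K₀ γ) (sumOver L γ))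
  where
  regroup : ∀ q q₀ s → q - q₀ + s ≡ q + s - q₀
  regroup = solve-∀

quadraticPoly-⊗ : ∀ n k β → quadraticPoly (n ⊗ k) (λ _ → 0ℤ) β ≡ sumOver n β * sumOver k β
quadraticPoly-⊗ n k β = trans (cong₂ _+_ (quadratic-⊗ n k β) (sumOver-zero β)) (+-identityʳ _)

Vanishing : Poly → Set
Vanishing R = ∀ γ → R γ ≡ 0ℤ

record Reduct (reduced : List Poly) (Q P : Poly) (S : List ℕ) : Set where
  field
    remainder  : Poly
    split      : ∀ γ → P (S ++ γ) ≡ Q γ + remainder γ + P S
    controlled : remainder ∈ reduced ⊎ Vanishing remainder

mkReduct : ∀ {reduced Q P S} (D R : Poly) → (∀ γ → P (S ++ γ) ≡ P S + D γ) →
  (∀ γ → R γ ≡ D γ - Q γ) → R ∈ reduced ⊎ Vanishing R → Reduct reduced Q P S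
mkReduct {Q = Q} {P} {S} D R P-split R≡D-Q controlled = record
  { remainder  = R
  ; split      = λ γ → trans (P-split γ) (trans (regroup (D γ) (Q γ) (P S))
                                                (cong (λ z → Q γ + z + P S) (sym (R≡D-Q γ))))
  ; controlled = controlled
  }
  where
  regroup : ∀ d q p → p + d ≡ q + (d - q) + p
  regroup = solve-∀

Group : Set
Group = Kernel × List (ℕ → ℤ)

members : List Group → List (ℕ → ℤ) → List Poly
members gs ls = concatMap (λ (K , Ls) → map (quadraticPoly K) Ls) gs ++ map sumOver ls

data Member (gs : List Group) (ls : List (ℕ → ℤ)) : Poly → Set where
  quadratic-member : ∀ {K Ls L} → (K , Ls) ∈ gs → L ∈ Ls → Member gs ls (quadraticPoly K L)
  linear-member    : ∀ {l} → l ∈ ls → Member gs ls (sumOver l)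

∈-members⁻ : ∀ gs ls {P} → P ∈ members gs ls → Member gs ls P
∈-members⁻ gs ls P∈ with ∈-++⁻ (concatMap (λ (K , Ls) → map (quadraticPoly K) Ls) gs) P∈
... | inj₁ P∈q with find (∈-concatMap⁻ (λ (K , Ls) → map (quadraticPoly K) Ls) {xs = gs} P∈q)
...   | _ , g∈ , P∈g with ∈-map⁻ _ P∈g
...     | _ , L∈ , refl = quadratic-member g∈ L∈
∈-members⁻ gs ls P∈ | inj₂ P∈l with ∈-map⁻ _ P∈l
... | _ , l∈ , refl = linear-member l∈

quadratic∈members : ∀ gs ls {K Ls L} → (K , Ls) ∈ gs → L ∈ Ls → quadraticPoly K L ∈ members gs ls
quadratic∈members gs ls g∈ L∈ = ∈-++⁺ˡ (∈-concatMap⁺ _ (lose g∈ (∈-map⁺ _ L∈)))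

linear∈members : ∀ gs {ls l} → l ∈ ls → sumOver l ∈ members gs ls
linear∈members gs l∈ = ∈-++⁺ʳ _ (∈-map⁺ _ l∈)

members-[] : ∀ gs ls {P} → P ∈ members gs ls → P [] ≡ 0ℤ
members-[] gs ls P∈ with ∈-members⁻ gs ls P∈
... | quadratic-member _ _ = refl
... | linear-member _      = refl

polarShifts : List (List ℕ) → Group → List (ℕ → ℤ)
polarShifts Ss (K , Ls) = cartesianProductWith (λ S L → L ⊕ polar K S) Ss Ls

∈-polarShifts : ∀ {Ss} K {Ls S L} → S ∈ Ss → L ∈ Ls → L ⊕ polar K S ∈ polarShifts Ss (K , Ls)
∈-polarShifts K = ∈-cartesianProductWith⁺ _

reduceByLinear : List (List ℕ) → (ℕ → ℤ) → List Group → List Group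
reduceByLinear Ss l₀ = map (λ (K , Ls) → K , map (_⊖ l₀) (polarShifts Ss (K , Ls)))

reduceByQuadratic : List (List ℕ) → Kernel → List Group → List Group
reduceByQuadratic Ss K₀ = map (λ (K , Ls) → K ⊟ K₀ , polarShifts Ss (K , Ls))

linearReduct : ∀ Ss l₀ gs ls {P} → P ∈ members gs (l₀ ∷ ls) → ∀ {S} → S ∈ Ss →
  Reduct (members (reduceByLinear Ss l₀ gs) (map (_⊖ l₀) ls)) (sumOver l₀) P S
linearReduct Ss l₀ gs ls P∈ {S} S∈ with ∈-members⁻ gs (l₀ ∷ ls) P∈
... | quadratic-member {K} {L = L} g∈ L∈ =
  mkReduct (quadraticPoly K (L ⊕ polar K S)) (quadraticPoly K ((L ⊕ polar K S) ⊖ l₀))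
    (quadraticPoly-++ K L S) (quadraticPoly-⊖ K (L ⊕ polar K S) l₀)
    (inj₁ (quadratic∈members (reduceByLinear Ss l₀ gs) _
             (∈-map⁺ _ g∈) (∈-map⁺ _ (∈-polarShifts K S∈ L∈))))
... | linear-member (here refl) =
  mkReduct (sumOver l₀) (λ _ → 0ℤ) (sumOver-++ l₀ S) (λ γ → sym (+-inverseʳ (sumOver l₀ γ)))
    (inj₂ (λ _ → refl))
... | linear-member {l} (there l∈) =
  mkReduct (sumOver l) (sumOver (l ⊖ l₀)) (sumOver-++ l S) (sumOver-- l l₀)
    (inj₁ (linear∈members (reduceByLinear Ss l₀ gs) (∈-map⁺ _ l∈)))

quadraticReduct : ∀ Ss K₀ Ls₀ gs {P} → P ∈ members ((K₀ , Ls₀) ∷ gs) [] → ∀ {S} → S ∈ Ss →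
  Reduct (members (reduceByQuadratic Ss K₀ gs) (polarShifts Ss (K₀ , Ls₀))) (quadratic K₀) P S
quadraticReduct Ss K₀ Ls₀ gs P∈ {S} S∈ with ∈-members⁻ ((K₀ , Ls₀) ∷ gs) [] P∈
... | quadratic-member {L = L} (here refl) L∈ =
  mkReduct (quadraticPoly K₀ (L ⊕ polar K₀ S)) (sumOver (L ⊕ polar K₀ S))
    (quadraticPoly-++ K₀ L S) (λ γ → cancel (quadratic K₀ γ) (sumOver (L ⊕ polar K₀ S) γ))
    (inj₁ (linear∈members (reduceByQuadratic Ss K₀ gs) (∈-polarShifts K₀ S∈ L∈)))
  where
  cancel : ∀ q s → s ≡ q + s - q
  cancel = solve-∀
... | quadratic-member {K} {L = L} (there g∈) L∈ =
  mkReduct (quadraticPoly K (L ⊕ polar K S)) (quadraticPoly (K ⊟ K₀) (L ⊕ polar K S))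
    (quadraticPoly-++ K L S) (quadraticPoly-⊟ K K₀ (L ⊕ polar K S))
    (inj₁ (quadratic∈members (reduceByQuadratic Ss K₀ gs) _
             (∈-map⁺ _ g∈) (∈-polarShifts K S∈ L∈)))
... | linear-member ()

-- Block 0 is FinNonemptySubset, as 0 < i unfolds to i ≥ 1.
Block : ℕ → List ℕ → Set
Block N β = Unique β × β ≢ [] × All (N <_) β

Block-mono : ∀ {M N β} → M ≤ N → Block N β → Block M β
Block-mono M≤N (unique , nonempty , above) = unique , nonempty , All.map (≤-<-trans M≤N) above

Block-++ : ∀ {N M S γ} → N ≤ M → Block N S → All (_≤ M) S → Block M γ → Block N (S ++ γ)
Block-++ {S = S} {γ} N≤M (uniqueS , nonemptyS , aboveS) S≤M (uniqueγ , _ , aboveγ) =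
  Unique.++⁺ uniqueS uniqueγ
    (λ (v∈S , v∈γ) → <-irrefl refl (≤-<-trans (All.lookup S≤M v∈S) (All.lookup aboveγ v∈γ))) ,
  nonemptyS ∘ ++-conicalˡ S γ ,
  All.++⁺ aboveS (All.map (≤-<-trans N≤M) aboveγ)

Monochromatic : ∀ {r} → List Poly → (ℤ → Fin r) → ℤ → List ℕ → Set
Monochromatic ms χ a β = ∀ {P} → P ∈ ms → χ (a + P β) ≡ χ a

Monochromatic-shift : ∀ {r ms} (χ : ℤ → Fin r) x {a β} →
  Monochromatic ms (χ ∘ (x +_)) a β → Monochromatic ms χ (x + a) β
Monochromatic-shift χ x {a} {β} mono {P} P∈ = trans (cong χ (+-assoc x a (P β))) (mono P∈)

Hit : ∀ {r} → List Poly → (ℤ → Fin r) → List (ℤ × List ℕ) → Set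
Hit ms χ cs = ∃[ c ] c ∈ cs × Monochromatic ms χ (proj₁ c) (proj₂ c)

-- The candidates do not depend on the colouring; this uniformity is what lets colour focusing
-- apply the induction hypothesis to the colouring of ℤ by colour profiles.
record Witnessed (ms : List Poly) (N r : ℕ) : Set where
  field
    candidates : List (ℤ × List ℕ)
    blocks     : ∀ {c} → c ∈ candidates → Block N (proj₂ c)
    hit        : (χ : ℤ → Fin r) → Hit ms χ candidates

witnessed-[] : ∀ N r → Witnessed [] N r
witnessed-[] N r = record
  { candidates = (0ℤ , suc N ∷ []) ∷ []
  ; blocks     = λ { (here refl) → ([] ∷ []) , (λ ()) , (n<1+n N ∷ []) }
  ; hit        = λ χ → _ , here refl , λ ()
  }

funToFin-injective : ∀ {m n} {f g : Fin m → Fin n} → funToFin f ≡ funToFin g → ∀ i → f i ≡ g i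
funToFin-injective {f = f} {g} eq i =
  trans (sym (finToFun-funToFin f i)) (trans (cong (λ c → finToFun c i) eq) (finToFun-funToFin g i))

colourProfile : ∀ {r} → (ℤ → Fin r) → (T : List ℤ) → ℤ → Fin (r ^ length T)
colourProfile χ T z = funToFin (λ i → χ (z + lookup T i))

colourProfile-≡ : ∀ {r} (χ : ℤ → Fin r) T y z → colourProfile χ T y ≡ colourProfile χ T z →
  ∀ {t} → t ∈ T → χ (y + t) ≡ χ (z + t)
colourProfile-≡ χ T y z eq t∈ =
  subst (λ u → χ (y + u) ≡ χ (z + u)) (sym (lookup-index t∈)) (funToFin-injective eq (Any.index t∈))

∷-preservesInjective : ∀ {n} {A : Set} {a} {c : Vector A n} →
  (∀ i → c i ≢ a) → Injective _≡_ _≡_ c → Injective _≡_ _≡_ (a Vector.∷ c)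
∷-preservesInjective fresh inj {zero}  {zero}  _  = refl
∷-preservesInjective fresh inj {zero}  {suc j} eq = ⊥-elim (fresh j (sym eq))
∷-preservesInjective fresh inj {suc i} {zero}  eq = ⊥-elim (fresh i eq)
∷-preservesInjective fresh inj {suc i} {suc j} eq = cong suc (inj eq)

-- Colour focusing

module ColourFocusing
  (ms : List Poly) (ms-[] : ∀ {P} → P ∈ ms → P [] ≡ 0ℤ)
  (Q : Poly) (reduce : List (List ℕ) → List Poly)
  (reduct : ∀ Ss {P} → P ∈ ms → ∀ {S} → S ∈ Ss → Reduct (reduce Ss) Q P S)
  (reduce-witnessed : ∀ Ss N r → Witnessed (reduce Ss) N r)
  (N r : ℕ)
  where

  Config : ℕ → Set
  Config s = ℤ × Vector (List ℕ) s

  Focal : ∀ {s} → (ℤ → Fin r) → Config s → Set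
  Focal {s} χ (f , S) = Σ (Vector (Fin r) s) λ colour →
    Injective _≡_ _≡_ colour × (∀ i {P} → P ∈ ms → χ (f + P (S i)) ≡ colour i)

  record Stage (s : ℕ) : Set where
    field
      solutions       : List (ℤ × List ℕ)
      configs         : List (Config s)
      solution-blocks : ∀ {c} → c ∈ solutions → Block N (proj₂ c)
      config-blocks   : ∀ {c} → c ∈ configs → ∀ i → Block N (proj₂ c i)
      cover           : (χ : ℤ → Fin r) → Hit ms χ solutions ⊎ ∃[ c ] c ∈ configs × Focal χ c

  stage₀ : Stage 0
  stage₀ = record
    { solutions       = []
    ; configs         = (0ℤ , Vector.[]) ∷ []
    ; solution-blocks = λ ()
    ; config-blocks   = λ { (here refl) () }
    ; cover           = λ χ → inj₂ (_ , here refl , Vector.[] , (λ { {()} }) , λ ())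
    }

  module Step {s} (stage : Stage s) where
    open Stage stage

    sets : List (List ℕ)
    sets = [] ∷ concatMap (toList ∘ proj₂) configs

    -- The level [] stands for the focus itself, since every member vanishes on [].
    points : List ℤ
    points = concatMap (λ (f , S) → cartesianProductWith (λ S′ P → f + P S′) ([] ∷ toList S) ms)
                       configs

    ∈-sets : ∀ {c} → c ∈ configs → ∀ {S′} → S′ ∈ [] ∷ toList (proj₂ c) → S′ ∈ sets
    ∈-sets c∈ (here refl) = here refl
    ∈-sets c∈ (there S′∈) = there (∈-concatMap⁺ _ (lose c∈ S′∈))

    ∈-points : ∀ {c} → c ∈ configs → ∀ {S′ P} → S′ ∈ [] ∷ toList (proj₂ c) → P ∈ ms →
      proj₁ c + P S′ ∈ points
    ∈-points c∈ S′∈ P∈ = ∈-concatMap⁺ _ (lose c∈ (∈-cartesianProductWith⁺ _ S′∈ P∈))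

    -- New blocks are taken above height, so that S ++ γ is a disjoint union for every level S.
    height : ℕ
    height = max N (concat sets)

    N≤height : N ≤ height
    N≤height = v≤max⁺ N (concat sets) (inj₁ ≤-refl)

    sets≤height : ∀ {S} → S ∈ sets → All (_≤ height) S
    sets≤height S∈ = All.tabulate (λ j∈ → All.lookup (xs≤max N (concat sets)) (∈-concat⁺′ j∈ S∈))

    open Witnessed (reduce-witnessed sets height (r ^ length points))
      renaming (candidates to shifts; blocks to shift-blocks; hit to shift-hit)

    configSolutions : List (ℤ × List ℕ)
    configSolutions = concatMap (λ (f , S) → map (f ,_) (toList S)) configs

    ∈-configSolutions : ∀ {c} → c ∈ configs → ∀ i → (proj₁ c , proj₂ c i) ∈ configSolutions
    ∈-configSolutions c∈ i = ∈-concatMap⁺ _ (lose c∈ (∈-map⁺ _ (∈-tabulate⁺ i)))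

    configSolution-blocks : ∀ {c} → c ∈ configSolutions → Block N (proj₂ c)
    configSolution-blocks c∈ with find (∈-concatMap⁻ _ {xs = configs} c∈)
    ... | _ , cfg∈ , c∈S with ∈-map⁻ _ c∈S
    ...   | _ , S∈ , refl with ∈-tabulate⁻ S∈
    ...     | i , refl = config-blocks cfg∈ i

    shift : ℤ × List ℕ → ℤ × List ℕ → ℤ × List ℕ
    shift (x , _) (a , β) = x + a , β

    extend : ℤ × List ℕ → Config s → Config (suc s)
    extend (x , γ) (f , S) = x + f - Q γ , γ Vector.∷ Vector.map (_++ γ) S

    nextSolutions : List (ℤ × List ℕ)
    nextSolutions = cartesianProductWith shift shifts (solutions ++ configSolutions)

    nextConfigs : List (Config (suc s))
    nextConfigs = cartesianProductWith extend shifts configs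

    nextSolution-blocks : ∀ {c} → c ∈ nextSolutions → Block N (proj₂ c)
    nextSolution-blocks c∈ with ∈-cartesianProductWith⁻ shift shifts (solutions ++ configSolutions) c∈
    ... | _ , b , _ , b∈ , refl = [ solution-blocks , configSolution-blocks ]′ (∈-++⁻ solutions b∈)

    nextConfig-blocks : ∀ {c} → c ∈ nextConfigs → ∀ i → Block N (proj₂ c i)
    nextConfig-blocks c∈ with ∈-cartesianProductWith⁻ extend shifts configs c∈
    ... | _ , _ , a∈ , c∈′ , refl = extend-blocks a∈ c∈′
      where
      extend-blocks : ∀ {a c} → a ∈ shifts → c ∈ configs → ∀ i → Block N (proj₂ (extend a c) i)
      extend-blocks a∈ c∈ zero    = Block-mono N≤height (shift-blocks a∈)
      extend-blocks a∈ c∈ (suc i) =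
        Block-++ N≤height (config-blocks c∈ i) (sets≤height (∈-sets c∈ (there (∈-tabulate⁺ i))))
                 (shift-blocks a∈)

    record Absorbs (χ : ℤ → Fin r) (x : ℤ) (γ : List ℕ) : Set where
      field
        absorb : ∀ {R} → R ∈ reduce sets ⊎ Vanishing R → ∀ {t} → t ∈ points →
                 χ (x + R γ + t) ≡ χ (x + t)

    absorbs : ∀ χ {x γ} → Monochromatic (reduce sets) (colourProfile χ points) x γ → Absorbs χ x γ
    absorbs χ {x} {γ} mono = record { absorb = absorb }
      where
      absorb : ∀ {R} → R ∈ reduce sets ⊎ Vanishing R → ∀ {t} → t ∈ points →
               χ (x + R γ + t) ≡ χ (x + t)
      absorb {R} (inj₁ R∈) t∈  = colourProfile-≡ χ points (x + R γ) x (mono R∈) t∈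
      absorb (inj₂ R≡0) {t} t∈ = cong (λ u → χ (u + t)) (trans (cong (x +_) (R≡0 γ)) (+-identityʳ x))

    -- Subtracting Q γ from the focus puts f + P S, shifted by x + R γ, at every new level S ∪ γ.
    absorbed-level : ∀ {χ x γ} → Absorbs χ x γ → ∀ {f S′ P} → S′ ∈ sets → P ∈ ms → f + P S′ ∈ points →
      χ (x + f - Q γ + P (S′ ++ γ)) ≡ χ (x + (f + P S′))
    absorbed-level {χ} {x} {γ} absorbed {f} {S′} {P} S′∈ P∈ t∈ =
      trans (cong χ (trans (cong (x + f - Q γ +_) (split γ)) (regroup x f (Q γ) (remainder γ) (P S′))))
            (Absorbs.absorb absorbed controlled t∈)
      where
      open Reduct (reduct sets P∈ S′∈)
      regroup : ∀ x f q ρ p → x + f - q + (q + ρ + p) ≡ x + ρ + (f + p)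
      regroup = solve-∀

    extend-focal : ∀ {χ x γ} → Absorbs χ x γ → ∀ {c} → c ∈ configs → (focal : Focal (χ ∘ (x +_)) c) →
      (∀ i → proj₁ focal i ≢ χ (x + proj₁ c)) → Focal χ (extend (x , γ) c)
    extend-focal {χ} {x} {γ} absorbed {f , S} c∈ (colour , injective , coloured) fresh =
      χ (x + f) Vector.∷ colour , ∷-preservesInjective fresh injective , level
      where
      level : ∀ i {P} → P ∈ ms →
        χ (x + f - Q γ + P (proj₂ (extend (x , γ) (f , S)) i)) ≡ (χ (x + f) Vector.∷ colour) i
      level zero    P∈ =
        trans (absorbed-level absorbed (here refl) P∈ (∈-points c∈ (here refl) P∈))
              (cong (λ u → χ (x + u)) (trans (cong (f +_) (ms-[] P∈)) (+-identityʳ f)))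
      level (suc i) P∈ =
        trans (absorbed-level absorbed (∈-sets c∈ Sᵢ∈) P∈ (∈-points c∈ Sᵢ∈ P∈)) (coloured i P∈)
        where
        Sᵢ∈ = there (∈-tabulate⁺ i)

    refocus : ∀ χ {x γ} → (x , γ) ∈ shifts → Absorbs χ x γ →
      Hit ms (χ ∘ (x +_)) solutions ⊎ ∃[ c ] c ∈ configs × Focal (χ ∘ (x +_)) c →
      Hit ms χ nextSolutions ⊎ ∃[ c ] c ∈ nextConfigs × Focal χ c
    refocus χ {x} xγ∈ absorbed (inj₁ (_ , aβ∈ , mono)) =
      inj₁ (_ , ∈-cartesianProductWith⁺ shift xγ∈ (∈-++⁺ˡ aβ∈) , Monochromatic-shift χ x mono)
    refocus χ {x} xγ∈ absorbed (inj₂ ((f , S) , c∈ , focal@(colour , _ , coloured)))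
      with any? (λ i → colour i ≟ᶠ χ (x + f))
    ... | yes (i , colourᵢ≡) =
      inj₁ (_ , ∈-cartesianProductWith⁺ shift xγ∈ (∈-++⁺ʳ solutions (∈-configSolutions c∈ i)) ,
            Monochromatic-shift χ x (λ P∈ → trans (coloured i P∈) colourᵢ≡))
    ... | no fresh =
      inj₂ (_ , ∈-cartesianProductWith⁺ extend xγ∈ c∈ ,
            extend-focal absorbed c∈ focal (λ i colourᵢ≡ → fresh (i , colourᵢ≡)))

    next : Stage (suc s)
    next = record
      { solutions       = nextSolutions
      ; configs         = nextConfigs
      ; solution-blocks = nextSolution-blocks
      ; config-blocks   = nextConfig-blocks
      ; cover           = λ χ →
          let (x , γ) , xγ∈ , mono = shift-hit (colourProfile χ points)
          in  refocus χ xγ∈ (absorbs χ {x} {γ} mono) (cover (χ ∘ (x +_)))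
      }

  stage : ∀ s → Stage s
  stage zero    = stage₀
  stage (suc s) = Step.next (stage s)

  witnessed : Witnessed ms N r
  witnessed = record
    { candidates = solutions
    ; blocks     = solution-blocks
    ; hit        = λ χ → [ id , (λ (_ , _ , _ , injective , _) → ⊥-elim (too-many-colours injective)) ]′
                           (cover χ)
    }
    where
    open Stage (stage (suc r))
    too-many-colours : {colour : Vector (Fin r) (suc r)} → ¬ Injective _≡_ _≡_ colour
    too-many-colours = <⇒notInjective (n<1+n r)

-- PET induction

-- Lexicographic in (number of kernel groups, number of linear members): removing the first
-- kernel group may create arbitrarily many linear members.
members-witnessed : ∀ w gs → length gs ≡ w → ∀ v ls → length ls ≡ v →
  ∀ N r → Witnessed (members gs ls) N r
members-witnessed w gs |gs| (suc v) (l₀ ∷ ls) |ls| =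
  ColourFocusing.witnessed
    (members gs (l₀ ∷ ls)) (members-[] gs (l₀ ∷ ls)) (sumOver l₀)
    (λ Ss → members (reduceByLinear Ss l₀ gs) (map (_⊖ l₀) ls))
    (λ Ss → linearReduct Ss l₀ gs ls)
    (λ Ss → members-witnessed w (reduceByLinear Ss l₀ gs) (trans (length-map _ gs) |gs|)
                              v (map (_⊖ l₀) ls) (trans (length-map _ ls) (suc-injective |ls|)))
members-witnessed (suc w) ((K₀ , Ls₀) ∷ gs) |gs| zero [] _ =
  ColourFocusing.witnessed
    (members ((K₀ , Ls₀) ∷ gs) []) (members-[] ((K₀ , Ls₀) ∷ gs) []) (quadratic K₀)
    (λ Ss → members (reduceByQuadratic Ss K₀ gs) (polarShifts Ss (K₀ , Ls₀)))
    (λ Ss → quadraticReduct Ss K₀ Ls₀ gs)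
    (λ Ss → members-witnessed w (reduceByQuadratic Ss K₀ gs) (trans (length-map _ gs) (suc-injective |gs|))
                              _ (polarShifts Ss (K₀ , Ls₀)) refl)
members-witnessed zero    []      _  zero    []      _  = witnessed-[]
members-witnessed _       _       _  zero    (_ ∷ _) ()
members-witnessed _       _       _  (suc _) []      ()
members-witnessed zero    (_ ∷ _) () zero    []      _
members-witnessed (suc _) []      () zero    []      _

proposition0p15 : (q : ℕ) (n k : Fin q → ℕ → ℤ) (r : ℕ) (χ : ℤ → Fin r) →
    Σ ℤ λ a → Σ (List ℕ) λ γ → FinNonemptySubset γ ×
      ((j : Fin q) → χ (a + sumOver (n j) γ * sumOver (k j) γ) ≡ χ a)
proposition0p15 q n k r χ =
  let (a , γ) , aγ∈ , mono = hit χ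
  in  a , γ , blocks aγ∈ , λ j →
        trans (cong (λ z → χ (a + z)) (sym (quadraticPoly-⊗ (n j) (k j) γ)))
              (mono (quadratic∈members products [] (∈-map⁺ _ (∈-allFin j)) (here refl)))
  where
  products : List Group
  products = map (λ j → n j ⊗ k j , (λ _ → 0ℤ) ∷ []) (allFin q)

  open Witnessed (members-witnessed _ products refl _ [] refl 0 r)
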